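{- Let $D=(V_1,V_2;A)$ be a 2-arc-strong split digraph. If $D$ has a pending decomposition, then $D$ has a strong arc decomposition.
   Context: A split digraph $D=(V_1,V_2;A)$ is a digraph whose vertex set is partitioned into $V_1$ and $V_2$, where $V_1$ is an independent set and $V_2$ induces a semicomplete digraph (every pair of distinct vertices of $V_2$ is joined by at least one arc). A digraph is strong if for every ordered pair of distinct vertices $x,y$ there is a directed $(x,y)$-path; it is 2-arc-strong if it remains strong after deleting any single arc. A strong arc decomposition of $D$ is a partition $A=A_1\cup A_2$ into disjoint arc sets such that both spanning subdigraphs $(V(D),A_1)$ and $(V(D),A_2)$ are strong. Two arc-disjoint strong subdigraphs $D_1,D_2$ of $D$ constitute a pending decomposition of $D$ if for each $i\in\{1,2\}$ we have $V_2\subseteq V(D_i)$, and every vertex $t\in V(D_i)\setminus V(D_{3-i})$ has at least one in-arc and at least one out-arc in $A(D)\setminus A(D_i)$. -}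

module Defs where

open import Data.Nat using (ℕ)
open import Data.Fin using (Fin)
open import Data.Bool using (Bool; true; false; _∧_; not)
open import Data.Product using (Σ; _×_; ∃-syntax)
open import Relation.Binary.PropositionalEquality using (_≡_; _≢_)
open import Relation.Nullary using (¬_; does)
open import Data.Fin using (_≟_)
open import Data.Sum using (_⊎_)

record Digraph (n : ℕ) : Set where
  field
    adj      : Fin n → Fin n → Bool
    loopless : ∀ x → adj x x ≡ false
open Digraph public

VSet : ℕ → Set
VSet n = Fin n → Bool

ASet : ℕ → Set
ASet n = Fin n → Fin n → Bool

-- Directed walks from x to y using only arcs of S between vertices of W.
-- (A walk from x to y exists iff a path from x to y exists.)
data Walk {n : ℕ} (W : VSet n) (S : ASet n) : Fin n → Fin n → Set where
  here : ∀ {x} → Walk W S x x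
  step : ∀ {x y z} → W x ≡ true → W y ≡ true → S x y ≡ true →
         Walk W S y z → Walk W S x z

StrongOn : {n : ℕ} → VSet n → ASet n → Set
StrongOn W S = ∀ x y → W x ≡ true → W y ≡ true → x ≢ y → Walk W S x y

allV : {n : ℕ} → VSet n
allV _ = true

Strong : {n : ℕ} → Digraph n → Set
Strong D = StrongOn allV (adj D)

deleteArc : {n : ℕ} → Digraph n → Fin n → Fin n → ASet n
deleteArc D u v x y = adj D x y ∧ not (eqArc u v x y)
  where
  eqArc : Fin _ → Fin _ → Fin _ → Fin _ → Bool
  eqArc u v x y = does (u ≟ x) ∧ does (v ≟ y)

TwoArcStrong : {n : ℕ} → Digraph n → Set
TwoArcStrong D = Strong D × (∀ u v → adj D u v ≡ true → StrongOn allV (deleteArc D u v))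

-- D = (V₁,V₂;A) is a split digraph, where V₂ = {x | inV₂ x ≡ true} and
-- V₁ is its complement: V₁ independent, V₂ semicomplete.
IsSplit : {n : ℕ} → Digraph n → VSet n → Set
IsSplit D inV₂ =
  (∀ x y → inV₂ x ≡ false → inV₂ y ≡ false → adj D x y ≡ false) ×
  (∀ x y → inV₂ x ≡ true → inV₂ y ≡ true → x ≢ y →
     (adj D x y ≡ true) ⊎ (adj D y x ≡ true))

IsSubdigraph : {n : ℕ} → Digraph n → VSet n → ASet n → Set
IsSubdigraph D W S =
  ∀ x y → S x y ≡ true → (adj D x y ≡ true) × (W x ≡ true) × (W y ≡ true)

PendingDecomposition : {n : ℕ} → Digraph n → VSet n → Set
PendingDecomposition {n} D inV₂ =
  Σ (VSet n) λ W₁ → Σ (ASet n) λ S₁ → Σ (VSet n) λ W₂ → Σ (ASet n) λ S₂ →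
    IsSubdigraph D W₁ S₁ × IsSubdigraph D W₂ S₂ ×
    StrongOn W₁ S₁ × StrongOn W₂ S₂ ×
    (∀ x y → ¬ ((S₁ x y ≡ true) × (S₂ x y ≡ true))) ×
    (∀ x → inV₂ x ≡ true → W₁ x ≡ true) ×
    (∀ x → inV₂ x ≡ true → W₂ x ≡ true) ×
    -- pending vertices of D₁ have an in-arc and an out-arc in A \ A(D₁)
    (∀ t → W₁ t ≡ true → W₂ t ≡ false →
       (∃[ u ] (adj D u t ≡ true × S₁ u t ≡ false)) ×
       (∃[ v ] (adj D t v ≡ true × S₁ t v ≡ false))) ×
    -- pending vertices of D₂ have an in-arc and an out-arc in A \ A(D₂)
    (∀ t → W₂ t ≡ true → W₁ t ≡ false →
       (∃[ u ] (adj D u t ≡ true × S₂ u t ≡ false)) ×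
       (∃[ v ] (adj D t v ≡ true × S₂ t v ≡ false)))

StrongArcDecomposition : {n : ℕ} → Digraph n → Set
StrongArcDecomposition {n} D =
  Σ (ASet n) λ c →
    StrongOn allV (λ x y → adj D x y ∧ c x y) ×
    StrongOn allV (λ x y → adj D x y ∧ not (c x y))

module Submission where

open import Data.Nat using (ℕ)
open import Data.Fin using (Fin; _≟_)
open import Data.Fin.Properties using (any?)
open import Data.Bool using (Bool; true; false; _∧_; not)
import Data.Bool.Properties as Bool
open import Data.Product using (_×_; _,_; proj₁; proj₂; ∃; ∃-syntax)
open import Data.Empty using (⊥-elim)
open import Relation.Nullary using (¬_; Dec; yes; no; does)
open import Relation.Nullary.Decidable using (dec-true; dec-false)
open import Relation.Binary.PropositionalEquality
open import Defs

-- Colour the arcs of D₁ with 1 and those of D₂ with 2. A vertex that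
-- is pending for D₁ (resp. D₂) lies in V₁, so all its neighbours lie in V₂ and
-- hence in both subdigraphs; colouring all its arcs 2 (resp. 1) attaches it to
-- D₂ (resp. D₁), and the pending condition guarantees that such arcs exist
-- outside D₂ (resp. D₁). A vertex of V₁ outside both subdigraphs has in- and
-- out-degree at least 2 by 2-arc-strong connectivity; one selected in-arc and
-- one selected out-arc get colour 1, all its other arcs colour 2. Each colour
-- class then consists of a strong Dᵢ plus an in-arc from and an out-arc to Dᵢ
-- at every other vertex, so it is strong.

private
  variable
    n : ℕ
    x y : Fin n

_⊆ᴬ_ : ASet n → ASet n → Set
S ⊆ᴬ C = ∀ {x y} → S x y ≡ true → C x y ≡ true

InArcFrom : VSet n → ASet n → Fin n → Set
InArcFrom W C t = ∃[ u ] (W u ≡ true × C u t ≡ true)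

OutArcTo : VSet n → ASet n → Fin n → Set
OutArcTo W C t = ∃[ v ] (W v ≡ true × C t v ≡ true)

module _ {W : VSet n} {S : ASet n} where

  _++ʷ_ : ∀ {z} → Walk W S x y → Walk W S y z → Walk W S x z
  here            ++ʷ q = q
  step wx wy s p ++ʷ q = step wx wy s (p ++ʷ q)

  Walk-mono : ∀ {C} → S ⊆ᴬ C → Walk W S x y → Walk allV C x y
  Walk-mono S⊆C here           = here
  Walk-mono S⊆C (step _ _ s p) = step refl refl (S⊆C s) (Walk-mono S⊆C p)

  Walk-firstArc : Walk W S x y → x ≢ y → ∃[ z ] S x z ≡ true
  Walk-firstArc here           x≢y = ⊥-elim (x≢y refl)
  Walk-firstArc (step _ _ s _) _   = _ , s

  Walk-lastArc : Walk W S x y → x ≢ y → ∃[ z ] S z y ≡ true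
  Walk-lastArc here x≢y = ⊥-elim (x≢y refl)
  Walk-lastArc {y = y} (step {y = z} _ _ s p) _ with z ≟ y
  ... | yes refl = _ , s
  ... | no z≢y   = Walk-lastArc p z≢y

-- The vertex s ≢ t only witnesses n ≥ 2, without which a strong digraph
-- need not have any arc at t.
module _ {W : VSet n} {S C : ASet n} (strong : StrongOn W S) (S⊆C : S ⊆ᴬ C)
  (attached : ∀ {s t} → s ≢ t → W t ≡ false → InArcFrom W C t × OutArcTo W C t)
  where

  private
    inside : ∀ {a b} → W a ≡ true → W b ≡ true → Walk allV C a b
    inside {a} {b} a∈W b∈W with a ≟ b
    ... | yes refl = here
    ... | no a≢b   = Walk-mono S⊆C (strong a b a∈W b∈W a≢b)

    enter : y ≢ x → ∃[ a ] (W a ≡ true × Walk allV C x a)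
    enter {x = x} y≢x with W x in x∈W
    ... | true  = x , x∈W , here
    ... | false = let _ , (v , v∈W , xv) = attached y≢x x∈W
                  in v , v∈W , step refl refl xv here

    leave : x ≢ y → ∃[ b ] (W b ≡ true × Walk allV C b y)
    leave {y = y} x≢y with W y in y∈W
    ... | true  = y , y∈W , here
    ... | false = let (u , u∈W , uy) , _ = attached x≢y y∈W
                  in u , u∈W , step refl refl uy here

  StrongOn-extend : StrongOn allV C
  StrongOn-extend x y _ _ x≢y =
    let a , a∈W , x⇝a = enter (λ y≡x → x≢y (sym y≡x))
        b , b∈W , b⇝y = leave x≢y
    in x⇝a ++ʷ (inside a∈W b∈W ++ʷ b⇝y)

module _ {p} {P : Fin n → Set p} where

  select : Dec (∃ P) → Fin n → Bool
  select (yes (w , _)) x = does (x ≟ w)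
  select (no _)        _ = false

  select-exists : (d : Dec (∃ P)) → P x → ∃[ w ] (P w × select d w ≡ true)
  select-exists (yes (w , pw)) _  = w , pw , dec-true (w ≟ w) refl
  select-exists (no ∄P)        px = ⊥-elim (∄P (_ , px))

  select-unique : (d : Dec (∃ P)) → select d x ≡ true → x ≢ y → select d y ≡ false
  select-unique {x = x} {y = y} (yes (w , _)) x≡w x≢y with x ≟ w
  ... | yes refl = dec-false (y ≟ x) (λ y≡x → x≢y (sym y≡x))

module _ (D : Digraph n) where

  adj⇒≢ : adj D x y ≡ true → x ≢ y
  adj⇒≢ {x = x} xy refl = Bool.not-¬ (loopless D x) xy

  Strong⇒inArc : Strong D → x ≢ y → ∃[ u ] adj D u y ≡ true
  Strong⇒inArc strong x≢y = Walk-lastArc (strong _ _ refl refl x≢y) x≢y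

  Strong⇒outArc : Strong D → x ≢ y → ∃[ v ] adj D x v ≡ true
  Strong⇒outArc strong x≢y = Walk-firstArc (strong _ _ refl refl x≢y) x≢y

  deleteArc-sound : ∀ {u v} → deleteArc D u v x y ≡ true → adj D x y ≡ true × ¬ (u ≡ x × v ≡ y)
  deleteArc-sound {x = x} {y = y} {u} {v} e with adj D x y | u ≟ x | v ≟ y
  ... | true | no u≢x | _      = refl , λ (u≡x , _) → u≢x u≡x
  ... | true | yes _  | no v≢y = refl , λ (_ , v≡y) → v≢y v≡y

  TwoArcStrong⇒otherInArc : TwoArcStrong D → ∀ {m t} → adj D m t ≡ true →
    ∃[ u ] (adj D u t ≡ true × u ≢ m)
  TwoArcStrong⇒otherInArc (_ , robust) {m} {t} mt =
    let m≢t = adj⇒≢ mt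
        u , ut = Walk-lastArc (robust m t mt m t refl refl m≢t) m≢t
        ut∈D , ut≢mt = deleteArc-sound ut
    in u , ut∈D , λ u≡m → ut≢mt (sym u≡m , refl)

  TwoArcStrong⇒otherOutArc : TwoArcStrong D → ∀ {m t} → adj D t m ≡ true →
    ∃[ v ] (adj D t v ≡ true × v ≢ m)
  TwoArcStrong⇒otherOutArc (_ , robust) {m} {t} tm =
    let t≢m = adj⇒≢ tm
        v , tv = Walk-firstArc (robust t m tm t m refl refl t≢m) t≢m
        tv∈D , tv≢tm = deleteArc-sound tv
    in v , tv∈D , λ v≡m → tv≢tm (refl , sym v≡m)

  module _ {inV₂ : VSet n} (split : IsSplit D inV₂) where

    IsSplit-tail∈V₂ : adj D x y ≡ true → inV₂ y ≡ false → inV₂ x ≡ true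
    IsSplit-tail∈V₂ {x = x} {y = y} xy y∉V₂ with inV₂ x in x∈?V₂
    ... | true  = refl
    ... | false = ⊥-elim (Bool.not-¬ (proj₁ split x y x∈?V₂ y∉V₂) xy)

    IsSplit-head∈V₂ : adj D x y ≡ true → inV₂ x ≡ false → inV₂ y ≡ true
    IsSplit-head∈V₂ {x = x} {y = y} xy x∉V₂ with inV₂ y in y∈?V₂
    ... | true  = refl
    ... | false = ⊥-elim (Bool.not-¬ (proj₁ split x y x∉V₂ y∈?V₂) xy)

  module _ {W : VSet n} {S : ASet n} (sub : IsSubdigraph D W S) where

    IsSubdigraph-tail∉ : W x ≡ false → S x y ≡ false
    IsSubdigraph-tail∉ {x = x} {y = y} x∉W with S x y in xy
    ... | true  = ⊥-elim (Bool.not-¬ x∉W (sub x y xy .proj₂ .proj₁))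
    ... | false = refl

    IsSubdigraph-head∉ : W y ≡ false → S x y ≡ false
    IsSubdigraph-head∉ {y = y} {x = x} y∉W with S x y in xy
    ... | true  = ⊥-elim (Bool.not-¬ y∉W (sub x y xy .proj₂ .proj₂))
    ... | false = refl

data Kind : Set where
  both only₁ only₂ neither : Kind

kind : Bool → Bool → Kind
kind true  true  = both
kind true  false = only₁
kind false true  = only₂
kind false false = neither

-- Colour (true = 1) of an arc in neither subdigraph, from the kinds of its ends
-- and whether it is the selected in-arc of its head / out-arc of its tail.
freeColour : Kind → Kind → Bool → Bool → Bool
freeColour only₁   _       _        _         = false
freeColour _       only₁   _        _         = false
freeColour only₂   _       _        _         = true
freeColour _       only₂   _        _         = true
freeColour _       neither selectIn _         = selectIn
freeColour neither _       _        selectOut = selectOut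
freeColour both    both    _        _         = true

arcColour : Bool → Bool → Kind → Kind → Bool → Bool → Bool
arcColour true  _    _ _ _ _ = true
arcColour false true _ _ _ _ = false
arcColour false false k l i o = freeColour k l i o

module Colouring (D : Digraph n) {inV₂ : VSet n} (split : IsSplit D inV₂) (tas : TwoArcStrong D)
  {W₁ : VSet n} {S₁ : ASet n} {W₂ : VSet n} {S₂ : ASet n}
  (sub₁ : IsSubdigraph D W₁ S₁) (sub₂ : IsSubdigraph D W₂ S₂)
  (disjoint : ∀ x y → ¬ ((S₁ x y ≡ true) × (S₂ x y ≡ true)))
  (V₂⊆W₁ : ∀ x → inV₂ x ≡ true → W₁ x ≡ true)
  (V₂⊆W₂ : ∀ x → inV₂ x ≡ true → W₂ x ≡ true)
  (pending₁ : ∀ t → W₁ t ≡ true → W₂ t ≡ false →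
     (∃[ u ] (adj D u t ≡ true × S₁ u t ≡ false)) × (∃[ v ] (adj D t v ≡ true × S₁ t v ≡ false)))
  (pending₂ : ∀ t → W₂ t ≡ true → W₁ t ≡ false →
     (∃[ u ] (adj D u t ≡ true × S₂ u t ≡ false)) × (∃[ v ] (adj D t v ≡ true × S₂ t v ≡ false)))
  where

  kindOf : Fin n → Kind
  kindOf x = kind (W₁ x) (W₂ x)

  selectedIn selectedOut : Fin n → Fin n → Bool
  selectedIn  x y = select (any? λ u → adj D u y Bool.≟ true) x
  selectedOut x y = select (any? λ v → adj D x v Bool.≟ true) y

  colour : ASet n
  colour x y = arcColour (S₁ x y) (S₂ x y) (kindOf x) (kindOf y) (selectedIn x y) (selectedOut x y)

  C₁ C₂ : ASet n
  C₁ x y = adj D x y ∧ colour x y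
  C₂ x y = adj D x y ∧ not (colour x y)

  colour-≡ : ∀ {a b k l} → S₁ x y ≡ a → S₂ x y ≡ b → kindOf x ≡ k → kindOf y ≡ l →
    colour x y ≡ arcColour a b k l (selectedIn x y) (selectedOut x y)
  colour-≡ refl refl refl refl = refl

  S₁⊆C₁ : S₁ ⊆ᴬ C₁
  S₁⊆C₁ {x} {y} xy = cong₂ _∧_ (sub₁ x y xy .proj₁) (colour-≡ xy refl refl refl)

  private
    S₂⇒∉S₁ : S₂ x y ≡ true → S₁ x y ≡ false
    S₂⇒∉S₁ {x} {y} xy with S₁ x y in xy∈S₁
    ... | true  = ⊥-elim (disjoint x y (xy∈S₁ , xy))
    ... | false = refl

  S₂⊆C₂ : S₂ ⊆ᴬ C₂
  S₂⊆C₂ {x} {y} xy = cong₂ _∧_ (sub₂ x y xy .proj₁) (cong not (colour-≡ (S₂⇒∉S₁ xy) xy refl refl))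

  private
    ∉W⇒∉V₂ : ∀ {W : VSet n} {t} → (∀ x → inV₂ x ≡ true → W x ≡ true) →
      W t ≡ false → inV₂ t ≡ false
    ∉W⇒∉V₂ {t = t} V₂⊆W t∉W with inV₂ t in t∈?V₂
    ... | true  = ⊥-elim (Bool.not-¬ t∉W (V₂⊆W t t∈?V₂))
    ... | false = refl

    kind-V₂ : inV₂ x ≡ true → kindOf x ≡ both
    kind-V₂ {x} x∈V₂ = cong₂ kind (V₂⊆W₁ x x∈V₂) (V₂⊆W₂ x x∈V₂)

    module _ {u t : Fin n} (ut : adj D u t ≡ true) (t∉V₂ : inV₂ t ≡ false)
      {k : Kind} (kt : kindOf t ≡ k) (ut∉S₁ : S₁ u t ≡ false) (ut∉S₂ : S₂ u t ≡ false) where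

      u∈V₂ : inV₂ u ≡ true
      u∈V₂ = IsSplit-tail∈V₂ D split ut t∉V₂

      colour-into : colour u t ≡ freeColour both k (selectedIn u t) (selectedOut u t)
      colour-into = colour-≡ ut∉S₁ ut∉S₂ (kind-V₂ u∈V₂) kt

      inArc₁ : freeColour both k (selectedIn u t) (selectedOut u t) ≡ true → InArcFrom W₁ C₁ t
      inArc₁ c = u , V₂⊆W₁ u u∈V₂ , cong₂ _∧_ ut (trans colour-into c)

      inArc₂ : freeColour both k (selectedIn u t) (selectedOut u t) ≡ false → InArcFrom W₂ C₂ t
      inArc₂ c = u , V₂⊆W₂ u u∈V₂ , cong₂ _∧_ ut (cong not (trans colour-into c))

    module _ {t v : Fin n} (tv : adj D t v ≡ true) (t∉V₂ : inV₂ t ≡ false)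
      {k : Kind} (kt : kindOf t ≡ k) (tv∉S₁ : S₁ t v ≡ false) (tv∉S₂ : S₂ t v ≡ false) where

      v∈V₂ : inV₂ v ≡ true
      v∈V₂ = IsSplit-head∈V₂ D split tv t∉V₂

      colour-out : colour t v ≡ freeColour k both (selectedIn t v) (selectedOut t v)
      colour-out = colour-≡ tv∉S₁ tv∉S₂ kt (kind-V₂ v∈V₂)

      outArc₁ : freeColour k both (selectedIn t v) (selectedOut t v) ≡ true → OutArcTo W₁ C₁ t
      outArc₁ c = v , V₂⊆W₁ v v∈V₂ , cong₂ _∧_ tv (trans colour-out c)

      outArc₂ : freeColour k both (selectedIn t v) (selectedOut t v) ≡ false → OutArcTo W₂ C₂ t
      outArc₂ c = v , V₂⊆W₂ v v∈V₂ , cong₂ _∧_ tv (cong not (trans colour-out c))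

    selectedInArc : x ≢ y → ∃[ u ] (adj D u y ≡ true × selectedIn u y ≡ true)
    selectedInArc x≢y = select-exists (any? _) (Strong⇒inArc D (proj₁ tas) x≢y .proj₂)

    selectedOutArc : x ≢ y → ∃[ v ] (adj D x v ≡ true × selectedOut x v ≡ true)
    selectedOutArc x≢y = select-exists (any? _) (Strong⇒outArc D (proj₁ tas) x≢y .proj₂)

    unselectedInArc : x ≢ y → ∃[ u ] (adj D u y ≡ true × selectedIn u y ≡ false)
    unselectedInArc x≢y =
      let m , my , m-selected = selectedInArc x≢y
          u , uy , u≢m = TwoArcStrong⇒otherInArc D tas my
      in u , uy , select-unique (any? _) m-selected (λ m≡u → u≢m (sym m≡u))

    unselectedOutArc : x ≢ y → ∃[ v ] (adj D x v ≡ true × selectedOut x v ≡ false)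
    unselectedOutArc x≢y =
      let m , xm , m-selected = selectedOutArc x≢y
          v , xv , v≢m = TwoArcStrong⇒otherOutArc D tas xm
      in v , xv , select-unique (any? _) m-selected (λ m≡v → v≢m (sym m≡v))

  private
    by-cases : ∀ {a} {A : Set a} b → (b ≡ true → A) → (b ≡ false → A) → A
    by-cases true  onTrue _       = onTrue refl
    by-cases false _      onFalse = onFalse refl

  attached₁ : ∀ {s t} → s ≢ t → W₁ t ≡ false → InArcFrom W₁ C₁ t × OutArcTo W₁ C₁ t
  attached₁ {s} {t} s≢t t∉W₁ = by-cases (W₂ t) pendingFor₂ outsideBoth
    where
    t∉V₂ : inV₂ t ≡ false
    t∉V₂ = ∉W⇒∉V₂ V₂⊆W₁ t∉W₁

    pendingFor₂ : W₂ t ≡ true → InArcFrom W₁ C₁ t × OutArcTo W₁ C₁ t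
    pendingFor₂ t∈W₂ =
      let (u , ut , ut∉S₂) , (v , tv , tv∉S₂) = pending₂ t t∈W₂ t∉W₁
          kt = cong₂ kind t∉W₁ t∈W₂
      in inArc₁ ut t∉V₂ kt (IsSubdigraph-head∉ D sub₁ t∉W₁) ut∉S₂ refl ,
         outArc₁ tv t∉V₂ kt (IsSubdigraph-tail∉ D sub₁ t∉W₁) tv∉S₂ refl

    outsideBoth : W₂ t ≡ false → InArcFrom W₁ C₁ t × OutArcTo W₁ C₁ t
    outsideBoth t∉W₂ =
      let u , ut , u-selected = selectedInArc s≢t
          v , tv , v-selected = selectedOutArc (λ t≡s → s≢t (sym t≡s))
          kt = cong₂ kind t∉W₁ t∉W₂
      in inArc₁ ut t∉V₂ kt (IsSubdigraph-head∉ D sub₁ t∉W₁) (IsSubdigraph-head∉ D sub₂ t∉W₂) u-selected ,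
         outArc₁ tv t∉V₂ kt (IsSubdigraph-tail∉ D sub₁ t∉W₁) (IsSubdigraph-tail∉ D sub₂ t∉W₂) v-selected

  attached₂ : ∀ {s t} → s ≢ t → W₂ t ≡ false → InArcFrom W₂ C₂ t × OutArcTo W₂ C₂ t
  attached₂ {s} {t} s≢t t∉W₂ = by-cases (W₁ t) pendingFor₁ outsideBoth
    where
    t∉V₂ : inV₂ t ≡ false
    t∉V₂ = ∉W⇒∉V₂ V₂⊆W₂ t∉W₂

    pendingFor₁ : W₁ t ≡ true → InArcFrom W₂ C₂ t × OutArcTo W₂ C₂ t
    pendingFor₁ t∈W₁ =
      let (u , ut , ut∉S₁) , (v , tv , tv∉S₁) = pending₁ t t∈W₁ t∉W₂
          kt = cong₂ kind t∈W₁ t∉W₂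
      in inArc₂ ut t∉V₂ kt ut∉S₁ (IsSubdigraph-head∉ D sub₂ t∉W₂) refl ,
         outArc₂ tv t∉V₂ kt tv∉S₁ (IsSubdigraph-tail∉ D sub₂ t∉W₂) refl

    outsideBoth : W₁ t ≡ false → InArcFrom W₂ C₂ t × OutArcTo W₂ C₂ t
    outsideBoth t∉W₁ =
      let u , ut , u-unselected = unselectedInArc s≢t
          v , tv , v-unselected = unselectedOutArc (λ t≡s → s≢t (sym t≡s))
          kt = cong₂ kind t∉W₁ t∉W₂
      in inArc₂ ut t∉V₂ kt (IsSubdigraph-head∉ D sub₁ t∉W₁) (IsSubdigraph-head∉ D sub₂ t∉W₂) u-unselected ,
         outArc₂ tv t∉V₂ kt (IsSubdigraph-tail∉ D sub₁ t∉W₁) (IsSubdigraph-tail∉ D sub₂ t∉W₂) v-unselected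

lemma2p2 : (n : ℕ) (D : Digraph n) (inV₂ : VSet n) →
    IsSplit D inV₂ → TwoArcStrong D →
    PendingDecomposition D inV₂ → StrongArcDecomposition D
lemma2p2 n D inV₂ split tas
  (W₁ , S₁ , W₂ , S₂ , sub₁ , sub₂ , strong₁ , strong₂ , disjoint , V₂⊆W₁ , V₂⊆W₂ , pending₁ , pending₂) =
  colour , StrongOn-extend strong₁ S₁⊆C₁ attached₁ , StrongOn-extend strong₂ S₂⊆C₂ attached₂
  where open Colouring D split tas sub₁ sub₂ disjoint V₂⊆W₁ V₂⊆W₂ pending₁ pending₂
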